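{- Let $\lambda\in\mathbb{Q}\setminus\{0,-1\}$. Then $a_\lambda(p)$ is even for every prime $p\nmid 2N_\lambda$. Furthermore, for such $p$ and integers $d\ge0$, $a_\lambda(p^d)$ is odd if and only if $d$ is even.
   Context: For $\lambda\in\mathbb{Q}\setminus\{0,-1\}$ let $E_\lambda/\mathbb{Q}$ be the elliptic curve $y^2=(x-1)\left(x^2-\frac{1}{\lambda+1}\right)$, with conductor $N_\lambda$. For primes $p\nmid 2N_\lambda$ put $b_\lambda(p)=p+1-\#E_\lambda(\mathbb{F}_p)$. Define $$\sum_{n\ge1}\frac{a_\lambda(n)}{n^s}:=\prod_{p\nmid\lambda(\lambda+1)}\frac{1}{1-a_\lambda(p)p^{ -s}+p^{2-2s}},$$ the product over primes $p$ with $\mathrm{ord}_p(\lambda(\lambda+1))=0$, where for such $p\nmid 2N_\lambda$, $a_\lambda(p)=\gamma\,(b_\lambda(p)^2-2p)$ with $\gamma=\left(\frac{\lambda+1}{p}\right)$ the Legendre symbol. Thus $a_\lambda(p^m)=a_\lambda(p)a_\lambda(p^{m-1})-p^2a_\lambda(p^{m-2})$ for such $p$, with $a_\lambda(1)=1$. -}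

module Defs where

open import Data.Nat as ℕ using (ℕ; suc)
open import Data.Nat.Divisibility using (_∣_; _∣?_)
open import Data.Integer as ℤ using (ℤ; +_; -_; ∣_∣)
open import Data.Rational using (ℚ; ↥_; ↧_)
open import Data.List using (List; length; filter; cartesianProduct; upTo)
open import Data.Bool.ListAction using (any)
open import Data.Product using (_×_; _,_)
open import Relation.Nullary using (does)
open import Data.Bool using (if_then_else_)

-- Throughout, λ = n / d with n = ↥ l ∈ ℤ, d = ↧ l ∈ ℤ (d > 0), so
-- λ + 1 = (n + d) / d.  Primes p are natural numbers; residues mod p
-- are represented by 0, 1, …, p-1 (List 'upTo p').

EvenZ : ℤ → Set
EvenZ z = 2 ∣ ∣ z ∣

_∣ℤ_ : ℕ → ℤ → Set
p ∣ℤ z = p ∣ ∣ z ∣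

-- λ and λ+1 are both p-units, i.e. ord_p(λ(λ+1)) = 0
-- (for a prime p: p divides none of num λ, den λ, num(λ+1) = n + d).
UnitAt : ℚ → ℕ → Set
UnitAt l p = (p ∣ℤ (↥ l) → Data.Empty.⊥) × (p ∣ℤ (↧ l) → Data.Empty.⊥)
           × (p ∣ℤ ((↥ l) ℤ.+ (↧ l)) → Data.Empty.⊥)
  where import Data.Empty

-- The affine point condition of E_λ mod p at (x, y):
--   y² ≡ (x - 1)(x² - 1/(λ+1))  (mod p),
-- written after multiplying by the p-unit (n + d) = (λ+1)·d, i.e.
--   (n + d)(y² - (x - 1)x²) + d(x - 1) ≡ 0 (mod p).
pointPoly : ℚ → ℤ → ℤ → ℤ
pointPoly l x y =
  (n ℤ.+ d) ℤ.* (y ℤ.* y ℤ.- (x ℤ.- + 1) ℤ.* x ℤ.* x) ℤ.+ d ℤ.* (x ℤ.- + 1)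
  where
  n = ↥ l
  d = ↧ l

-- #E_λ(F_p) = 1 (point at infinity) + number of affine solutions in F_p².
#E : ℚ → ℕ → ℕ
#E l p = suc (length (filter (λ xy → p ∣? ∣ pt xy ∣)
                              (cartesianProduct (upTo p) (upTo p))))
  where
  pt : ℕ × ℕ → ℤ
  pt (x , y) = pointPoly l (+ x) (+ y)

bλ : ℚ → ℕ → ℤ
bλ l p = + (suc p) ℤ.- + (#E l p)

-- Legendre symbol ((λ+1)/p), for p with λ+1 a p-unit:
-- +1 if λ+1 = (n+d)/d is a square mod p, i.e. ∃ x, x²·d ≡ n + d (mod p);
-- -1 otherwise.
legendreλ+1 : ℚ → ℕ → ℤ
legendreλ+1 l p =
  if any (λ x → does (p ∣? ∣ (+ x) ℤ.* (+ x) ℤ.* d ℤ.- (n ℤ.+ d) ∣)) (upTo p)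
  then + 1 else - (+ 1)
  where
  n = ↥ l
  d = ↧ l

aλp : ℚ → ℕ → ℤ
aλp l p = legendreλ+1 l p ℤ.* (b ℤ.* b ℤ.- + (2 ℕ.* p))
  where b = bλ l p

-- a_λ(p^m) from the Euler factor 1/(1 - a_λ(p) p^{-s} + p^{2-2s}):
-- a(1) = 1, a(p) = a_λ(p), a(p^m) = a_λ(p) a(p^{m-1}) - p² a(p^{m-2}).
aλpow : ℚ → ℕ → ℕ → ℤ
aλpow l p 0 = + 1
aλpow l p 1 = aλp l p
aλpow l p (suc (suc m)) =
  aλp l p ℤ.* aλpow l p (suc m) ℤ.- + (p ℕ.* p) ℤ.* aλpow l p m

-- #E_λ(F_p) is even: for fixed x the involution y ↦ -y pairs off the affine points (x, y) with
-- y ≠ 0, so mod 2 only the points (x, 0) count, i.e. the roots of (x - 1)(x² - 1/(λ+1)).  The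
-- roots of the quadratic come in pairs ±x (p odd, p ∤ d) and miss x = 1 (p ∤ n), so there is an
-- odd number of points (x, 0), and with the point at infinity #E is even.  Hence b_λ(p) and
-- a_λ(p) = γ (b_λ(p)² - 2p) are even, and since p² is odd the recurrence gives
-- a_λ(p^(m+2)) ≡ a_λ(p^m) (mod 2), starting from a_λ(1) = 1 and a_λ(p) even.
module Submission where

open import Defs
open import Data.Nat using (ℕ)
open import Data.Nat.Divisibility using (_∣_)
open import Data.Nat.Primality using (Prime)
open import Data.Rational using (ℚ; 0ℚ; 1ℚ; -_)
open import Data.Product using (_×_)
open import Relation.Binary.PropositionalEquality using (_≢_)
open import Relation.Nullary using (¬_)
open import Function.Bundles using (_⇔_)

open import Data.Nat as ℕ using (zero; suc; _+_; _<_; s≤s; z≤n; parity; nonTrivial⇒n>1)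
open import Data.Nat.Properties using (+-suc; +-identityʳ; suc-injective; <-irrefl; <⇒≱; m≤n⇒m≤1+n)
open import Data.Nat.Divisibility
  using (_∣?_; ∣-refl; _∣0; m∣m*n; ∣n⇒∣m*n; ∣1⇒≡1; ∣⇒≤; ∣m∣n⇒∣m+n; ∣m+n∣m⇒∣n)
open import Data.Nat.Primality using (prime⇒irreducible; prime⇒nonTrivial; euclidsLemma)
open import Data.Parity.Base as ℙ using (0ℙ; 1ℙ)
import Data.Parity.Properties as ℙ
open import Data.Integer as ℤ using (ℤ; +_; ∣_∣)
open import Data.Integer.Properties using (abs-*; ∣-i∣≡∣i∣)
open import Data.Integer.Divisibility.Signed as S using (∣ᵤ⇒∣; ∣⇒∣ᵤ) renaming (_∣_ to _∣ₛ_)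
open import Data.Integer.Tactic.RingSolver using (solve-∀)
open import Data.Rational using (↥_; ↧_)
open import Data.List using (List; []; _∷_; [_]; _++_; _∷ʳ_; length; filter; map; applyUpTo; upTo; cartesianProduct)
open import Data.List.Properties
  using (filter-++; length-++; filter-accept; filter-reject; applyUpTo-∷ʳ; map-upTo)
open import Data.Product using (_,_; ∃-syntax)
open import Data.Sum using (inj₁; inj₂)
open import Data.Empty using (⊥-elim)
open import Level using (0ℓ)
open import Relation.Unary using (Pred; Decidable)
open import Relation.Nullary using (yes; no)
open import Relation.Binary.PropositionalEquality
  using (_≡_; refl; sym; trans; cong; cong₂; subst; module ≡-Reasoning)
open import Function using (_∘_; id)
open import Function.Bundles using (mk⇔; Equivalence)
open Equivalence using (to; from)

module _ {a b ℓ ℓ′} {A : Set a} {B : Set b} {P : Pred A ℓ} {Q : Pred B ℓ′}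
         (P? : Decidable P) (Q? : Decidable Q) where

  length-filter-[]-cong : ∀ {x y} → P x ⇔ Q y → length (filter P? [ x ]) ≡ length (filter Q? [ y ])
  length-filter-[]-cong {x} {y} Px⇔Qy with P? x | Q? y
  ... | yes _  | yes _  = refl
  ... | yes px | no ¬qy = ⊥-elim (¬qy (to Px⇔Qy px))
  ... | no ¬px | yes qy = ⊥-elim (¬px (from Px⇔Qy qy))
  ... | no _   | no _   = refl

module _ {a ℓ} {A : Set a} {P : Pred A ℓ} (P? : Decidable P) where

  length-filter-∷ : ∀ x xs → length (filter P? (x ∷ xs)) ≡ length (filter P? [ x ]) + length (filter P? xs)
  length-filter-∷ x xs = trans (cong length (filter-++ P? [ x ] xs)) (length-++ (filter P? [ x ]))

  parity-length-filter-++ : ∀ xs ys →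
    parity (length (filter P? (xs ++ ys))) ≡ parity (length (filter P? xs)) ℙ.+ parity (length (filter P? ys))
  parity-length-filter-++ xs ys = begin
    parity (length (filter P? (xs ++ ys)))                      ≡⟨ cong (parity ∘ length) (filter-++ P? xs ys) ⟩
    parity (length (filter P? xs ++ filter P? ys))              ≡⟨ cong parity (length-++ (filter P? xs)) ⟩
    parity (length (filter P? xs) + length (filter P? ys))      ≡⟨ ℙ.+-homo-+ (length (filter P? xs)) _ ⟩
    parity (length (filter P? xs)) ℙ.+ parity (length (filter P? ys)) ∎
    where open ≡-Reasoning

  parity-filter-applyUpTo-palindrome : ∀ (f : ℕ → A) k →
    (∀ i j → suc (i + j) ≡ k + k → P (f i) → P (f j)) →
    parity (length (filter P? (applyUpTo f (k + k)))) ≡ 0ℙ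
  parity-filter-applyUpTo-palindrome f zero    mirror = refl
  parity-filter-applyUpTo-palindrome f (suc k) mirror = begin
    parity (count (f 0 ∷ applyUpTo (f ∘ suc) (k + suc k)))
      ≡⟨ cong (λ m → parity (count (f 0 ∷ applyUpTo (f ∘ suc) m))) (+-suc k k) ⟩
    parity (count (f 0 ∷ applyUpTo (f ∘ suc) (suc (k + k))))
      ≡⟨ cong (λ xs → parity (count (f 0 ∷ xs))) (sym (applyUpTo-∷ʳ (f ∘ suc) (k + k))) ⟩
    parity (count (f 0 ∷ (middle ∷ʳ f last)))
      ≡⟨ parity-length-filter-++ [ f 0 ] (middle ∷ʳ f last) ⟩
    parity (count [ f 0 ]) ℙ.+ parity (count (middle ∷ʳ f last))
      ≡⟨ cong (parity (count [ f 0 ]) ℙ.+_) (parity-length-filter-++ middle [ f last ]) ⟩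
    parity (count [ f 0 ]) ℙ.+ (parity (count middle) ℙ.+ parity (count [ f last ]))
      ≡⟨ cong₂ (λ u v → parity (count [ f 0 ]) ℙ.+ (u ℙ.+ parity v)) ih ends ⟩
    parity (count [ f 0 ]) ℙ.+ parity (count [ f 0 ])
      ≡⟨ ℙ.p+p≡0ℙ (parity (count [ f 0 ])) ⟩
    0ℙ ∎
    where
    open ≡-Reasoning
    count : List A → ℕ
    count xs = length (filter P? xs)
    last : ℕ
    last = suc (k + k)
    middle : List A
    middle = applyUpTo (f ∘ suc) (k + k)
    ih : parity (count middle) ≡ 0ℙ
    ih = parity-filter-applyUpTo-palindrome (f ∘ suc) k λ i j e →
      mirror (suc i) (suc j) (cong suc (trans (cong suc (+-suc i j)) (trans (cong suc e) (sym (+-suc k k)))))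
    ends : count [ f last ] ≡ count [ f 0 ]
    ends = length-filter-[]-cong P? P? (mk⇔
      (mirror last 0 (cong suc (trans (+-identityʳ last) (sym (+-suc k k)))))
      (mirror 0 last (cong suc (sym (+-suc k k)))))

module _ {a ℓ ℓ′} {A : Set a} {P : Pred A ℓ} {Q : Pred A ℓ′} (P? : Decidable P) (Q? : Decidable Q) where

  length-filter-applyUpTo-cong : ∀ (f : ℕ → A) n → (∀ j → j < n → P (f j) ⇔ Q (f j)) →
    length (filter P? (applyUpTo f n)) ≡ length (filter Q? (applyUpTo f n))
  length-filter-applyUpTo-cong f zero agree = refl
  length-filter-applyUpTo-cong f (suc n) agree = begin
    length (filter P? (applyUpTo f (suc n)))
      ≡⟨ length-filter-∷ P? (f 0) _ ⟩
    length (filter P? [ f 0 ]) + length (filter P? (applyUpTo (f ∘ suc) n))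
      ≡⟨ cong₂ _+_ (length-filter-[]-cong P? Q? (agree 0 (s≤s z≤n)))
                   (length-filter-applyUpTo-cong (f ∘ suc) n (λ j j<n → agree (suc j) (s≤s j<n))) ⟩
    length (filter Q? [ f 0 ]) + length (filter Q? (applyUpTo (f ∘ suc) n))
      ≡⟨ length-filter-∷ Q? (f 0) _ ⟨
    length (filter Q? (applyUpTo f (suc n)))
      ∎
    where open ≡-Reasoning

  length-filter-applyUpTo-except : ∀ (f : ℕ → A) n i → i < n → P (f i) → ¬ Q (f i) →
    (∀ j → j < n → j ≢ i → P (f j) ⇔ Q (f j)) →
    length (filter P? (applyUpTo f n)) ≡ suc (length (filter Q? (applyUpTo f n)))
  length-filter-applyUpTo-except f (suc n) zero _ Pf0 ¬Qf0 agree = begin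
    length (filter P? (applyUpTo f (suc n)))          ≡⟨ cong length (filter-accept P? Pf0) ⟩
    suc (length (filter P? (applyUpTo (f ∘ suc) n)))  ≡⟨ cong suc (length-filter-applyUpTo-cong (f ∘ suc) n agree′) ⟩
    suc (length (filter Q? (applyUpTo (f ∘ suc) n)))  ≡⟨ cong (suc ∘ length) (filter-reject Q? ¬Qf0) ⟨
    suc (length (filter Q? (applyUpTo f (suc n))))    ∎
    where
    open ≡-Reasoning
    agree′ : ∀ j → j < n → P (f (suc j)) ⇔ Q (f (suc j))
    agree′ j j<n = agree (suc j) (s≤s j<n) (λ ())
  length-filter-applyUpTo-except f (suc n) (suc i) (s≤s i<n) Pfi ¬Qfi agree = begin
    length (filter P? (applyUpTo f (suc n)))
      ≡⟨ length-filter-∷ P? (f 0) _ ⟩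
    length (filter P? [ f 0 ]) + length (filter P? (applyUpTo (f ∘ suc) n))
      ≡⟨ cong₂ _+_ (length-filter-[]-cong P? Q? (agree 0 (s≤s z≤n) (λ ())))
                   (length-filter-applyUpTo-except (f ∘ suc) n i i<n Pfi ¬Qfi agree′) ⟩
    length (filter Q? [ f 0 ]) + suc (length (filter Q? (applyUpTo (f ∘ suc) n)))
      ≡⟨ +-suc _ _ ⟩
    suc (length (filter Q? [ f 0 ]) + length (filter Q? (applyUpTo (f ∘ suc) n)))
      ≡⟨ cong suc (length-filter-∷ Q? (f 0) _) ⟨
    suc (length (filter Q? (applyUpTo f (suc n))))
      ∎
    where
    open ≡-Reasoning
    agree′ : ∀ j → j < n → j ≢ i → P (f (suc j)) ⇔ Q (f (suc j))
    agree′ j j<n j≢i = agree (suc j) (s≤s j<n) (j≢i ∘ suc-injective)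

module _ {a b ℓ ℓ′} {A : Set a} {B : Set b} {P : Pred (A × B) ℓ} {Q : Pred A ℓ′}
         (P? : Decidable P) (Q? : Decidable Q) where

  parity-filter-cartesianProduct : ∀ xs ys →
    (∀ x → parity (length (filter P? (map (x ,_) ys))) ≡ parity (length (filter Q? [ x ]))) →
    parity (length (filter P? (cartesianProduct xs ys))) ≡ parity (length (filter Q? xs))
  parity-filter-cartesianProduct []       ys rows = refl
  parity-filter-cartesianProduct (x ∷ xs) ys rows = begin
    parity (length (filter P? (map (x ,_) ys ++ cartesianProduct xs ys)))
      ≡⟨ parity-length-filter-++ P? (map (x ,_) ys) _ ⟩
    parity (length (filter P? (map (x ,_) ys))) ℙ.+ parity (length (filter P? (cartesianProduct xs ys)))
      ≡⟨ cong₂ ℙ._+_ (rows x) (parity-filter-cartesianProduct xs ys rows) ⟩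
    parity (length (filter Q? [ x ])) ℙ.+ parity (length (filter Q? xs))
      ≡⟨ parity-length-filter-++ Q? [ x ] xs ⟨
    parity (length (filter Q? (x ∷ xs)))
      ∎
    where open ≡-Reasoning

2∤1 : ¬ 2 ∣ 1
2∤1 2∣1 with ∣1⇒≡1 2∣1
... | ()

parity[n+n]≡0ℙ : ∀ n → parity (n + n) ≡ 0ℙ
parity[n+n]≡0ℙ n = trans (ℙ.+-homo-+ n n) (ℙ.p+p≡0ℙ (parity n))

parity≡0ℙ⇒2∣ : ∀ n → parity n ≡ 0ℙ → 2 ∣ n
parity≡0ℙ⇒2∣ zero          _  = 2 ∣0
parity≡0ℙ⇒2∣ (suc (suc n)) eq = ∣m∣n⇒∣m+n (∣-refl {2}) (parity≡0ℙ⇒2∣ n eq)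

parity≡1ℙ⇒odd : ∀ n → parity n ≡ 1ℙ → ∃[ k ] n ≡ suc (k + k)
parity≡1ℙ⇒odd (suc zero)    _  = 0 , refl
parity≡1ℙ⇒odd (suc (suc n)) eq with parity≡1ℙ⇒odd n eq
... | k , refl = suc k , cong (suc ∘ suc) (sym (+-suc k k))

prime≢2⇒odd : ∀ {p} → Prime p → p ≢ 2 → ∃[ k ] p ≡ suc (k + k)
prime≢2⇒odd {p} p-prime p≢2 with parity p in eq
... | 1ℙ = parity≡1ℙ⇒odd p eq
... | 0ℙ with prime⇒irreducible p-prime (parity≡0ℙ⇒2∣ p eq)
...   | inj₂ 2≡p = ⊥-elim (p≢2 (sym 2≡p))

p∣x-1⇒x≡1 : ∀ {p x} → 1 < p → x < p → p ∣ℤ (+ x ℤ.- + 1) → x ≡ 1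
p∣x-1⇒x≡1 {x = zero}        1<p _   p∣1 = ⊥-elim (<-irrefl (sym (∣1⇒≡1 p∣1)) 1<p)
p∣x-1⇒x≡1 {x = suc zero}    _   _   _   = refl
p∣x-1⇒x≡1 {x = suc (suc x)} _   x<p p∣x = ⊥-elim (<⇒≱ x<p (m≤n⇒m≤1+n (∣⇒≤ p∣x)))

∣ℤ-shift : ∀ {p z′} z w → z′ ≡ z ℤ.+ + p ℤ.* w → p ∣ℤ z → p ∣ℤ z′
∣ℤ-shift {p} {z′} z w z′≡z+pw p∣z =
  ∣⇒∣ᵤ {+ p} {z′} (subst (+ p ∣ₛ_) (sym z′≡z+pw) (S.∣m∣n⇒∣m+n (∣ᵤ⇒∣ {+ p} {z} p∣z) (S.∣m⇒∣m*n w S.∣-refl)))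

even[ax-qy]⇔even[y] : ∀ {a} x y {q} → parity q ≡ 1ℙ → EvenZ a → EvenZ (a ℤ.* x ℤ.- + q ℤ.* y) ⇔ EvenZ y
even[ax-qy]⇔even[y] {a} x y {q} q-odd 2∣a with parity≡1ℙ⇒odd q q-odd
... | w , refl = mk⇔ (λ 2∣t → ∣⇒∣ᵤ {+ 2} {y} (S.∣m+n∣m⇒∣n 2∣t+y (∣ᵤ⇒∣ {+ 2} {t} 2∣t)))
                     (λ 2∣y → ∣⇒∣ᵤ {+ 2} {t} (S.∣m+n∣n⇒∣m 2∣t+y (∣ᵤ⇒∣ {+ 2} {y} 2∣y)))
  where
  t : ℤ
  t = a ℤ.* x ℤ.- + suc (w + w) ℤ.* y
  2∣w+w : + 2 ∣ₛ + w ℤ.+ + w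
  2∣w+w = ∣ᵤ⇒∣ {+ 2} {+ (w + w)} (parity≡0ℙ⇒2∣ (w + w) (parity[n+n]≡0ℙ w))
  -- + suc (w + w) computes to + 1 ℤ.+ (+ w ℤ.+ + w), the form the solver can see
  t+y≡ : ∀ a x y w → (a ℤ.* x ℤ.- (+ 1 ℤ.+ (w ℤ.+ w)) ℤ.* y) ℤ.+ y ≡ a ℤ.* x ℤ.- (w ℤ.+ w) ℤ.* y
  t+y≡ = solve-∀
  2∣t+y : + 2 ∣ₛ t ℤ.+ y
  2∣t+y = subst (+ 2 ∣ₛ_) (sym (t+y≡ a x y (+ w)))
            (S.∣m∣n⇒∣m-n (S.∣m⇒∣m*n x (∣ᵤ⇒∣ {+ 2} {a} 2∣a)) (S.∣m⇒∣m*n y 2∣w+w))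

alternating-parity : (u : ℕ → ℤ) → ¬ EvenZ (u 0) → EvenZ (u 1) →
  (∀ m → EvenZ (u (suc (suc m))) ⇔ EvenZ (u m)) →
  ∀ m → (¬ EvenZ (u m)) ⇔ (2 ∣ m)
alternating-parity u odd₀ even₁ step zero          = mk⇔ (λ _ → 2 ∣0) (λ _ → odd₀)
alternating-parity u odd₀ even₁ step (suc zero)    = mk⇔ (λ odd₁ → ⊥-elim (odd₁ even₁)) (⊥-elim ∘ 2∤1)
alternating-parity u odd₀ even₁ step (suc (suc m)) =
  mk⇔ (λ odd → ∣m∣n⇒∣m+n (∣-refl {2}) (to ih (odd ∘ from (step m))))
      (λ 2∣2+m → from ih (∣m+n∣m⇒∣n 2∣2+m (∣-refl {2})) ∘ to (step m))
  where
  ih : (¬ EvenZ (u m)) ⇔ (2 ∣ m)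
  ih = alternating-parity u odd₀ even₁ step m

pointPoly-reflect : ∀ l x y y′ →
  pointPoly l x y′ ≡ pointPoly l x y ℤ.+ (y ℤ.+ y′) ℤ.* ((↥ l ℤ.+ ↧ l) ℤ.* (y′ ℤ.- y))
pointPoly-reflect l = identity (↥ l) (↧ l)
  where
  identity : ∀ n d x y y′ →
    (n ℤ.+ d) ℤ.* (y′ ℤ.* y′ ℤ.- (x ℤ.- + 1) ℤ.* x ℤ.* x) ℤ.+ d ℤ.* (x ℤ.- + 1)
      ≡ ((n ℤ.+ d) ℤ.* (y ℤ.* y ℤ.- (x ℤ.- + 1) ℤ.* x ℤ.* x) ℤ.+ d ℤ.* (x ℤ.- + 1))
        ℤ.+ (y ℤ.+ y′) ℤ.* ((n ℤ.+ d) ℤ.* (y′ ℤ.- y))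
  identity = solve-∀

pointPoly-x-axis : ∀ l x → pointPoly l x (+ 0) ≡ (x ℤ.- + 1) ℤ.* (↧ l ℤ.- (↥ l ℤ.+ ↧ l) ℤ.* x ℤ.* x)
pointPoly-x-axis l = identity (↥ l) (↧ l)
  where
  identity : ∀ n d x →
    (n ℤ.+ d) ℤ.* (+ 0 ℤ.* + 0 ℤ.- (x ℤ.- + 1) ℤ.* x ℤ.* x) ℤ.+ d ℤ.* (x ℤ.- + 1)
      ≡ (x ℤ.- + 1) ℤ.* (d ℤ.- (n ℤ.+ d) ℤ.* x ℤ.* x)
  identity = solve-∀

module _ (l : ℚ) (k : ℕ) where

  private
    p : ℕ
    p = suc (k + k)

  OnCurve : Pred (ℕ × ℕ) 0ℓ
  OnCurve (x , y) = p ∣ℤ pointPoly l (+ x) (+ y)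

  onCurve? : Decidable OnCurve
  onCurve? (x , y) = p ∣? ∣ pointPoly l (+ x) (+ y) ∣

  -- x² ≡ 1/(λ+1) (mod p), multiplied through by (λ+1)·d = n + d
  SqrtInv : Pred ℕ 0ℓ
  SqrtInv x = p ∣ℤ (↧ l ℤ.- (↥ l ℤ.+ ↧ l) ℤ.* + x ℤ.* + x)

  sqrtInv? : Decidable SqrtInv
  sqrtInv? x = p ∣? ∣ ↧ l ℤ.- (↥ l ℤ.+ ↧ l) ℤ.* + x ℤ.* + x ∣

  onCurve-reflect : ∀ x {y y′} → y + y′ ≡ p → OnCurve (x , y) → OnCurve (x , y′)
  onCurve-reflect x {y} {y′} y+y′≡p = ∣ℤ-shift (pointPoly l (+ x) (+ y)) w
    (trans (pointPoly-reflect l (+ x) (+ y) (+ y′)) (cong (λ c → pointPoly l (+ x) (+ y) ℤ.+ + c ℤ.* w) y+y′≡p))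
    where
    w : ℤ
    w = (↥ l ℤ.+ ↧ l) ℤ.* (+ y′ ℤ.- + y)

  sqrtInv-reflect : ∀ {x x′} → x + x′ ≡ p → SqrtInv x → SqrtInv x′
  sqrtInv-reflect {x} {x′} x+x′≡p = ∣ℤ-shift z w
    (trans (identity (↥ l ℤ.+ ↧ l) (↧ l) (+ x) (+ x′)) (cong (λ c → z ℤ.+ + c ℤ.* w) x+x′≡p))
    where
    z w : ℤ
    z = ↧ l ℤ.- (↥ l ℤ.+ ↧ l) ℤ.* + x ℤ.* + x
    w = (↥ l ℤ.+ ↧ l) ℤ.* (+ x ℤ.- + x′)
    identity : ∀ s d x x′ → d ℤ.- s ℤ.* x′ ℤ.* x′ ≡ (d ℤ.- s ℤ.* x ℤ.* x) ℤ.+ (x ℤ.+ x′) ℤ.* (s ℤ.* (x ℤ.- x′))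
    identity = solve-∀

  OnXAxis : Pred ℕ 0ℓ
  OnXAxis x = OnCurve (x , 0)

  onXAxis? : Decidable OnXAxis
  onXAxis? x = onCurve? (x , 0)

  parity-onCurve-row : ∀ x →
    parity (length (filter onCurve? (map (x ,_) (upTo p)))) ≡ parity (length (filter onXAxis? [ x ]))
  parity-onCurve-row x = begin
    parity (count (map (x ,_) (upTo p)))
      ≡⟨ cong (parity ∘ count) (map-upTo (x ,_) p) ⟩
    parity (count ((x , 0) ∷ applyUpTo (λ y → x , suc y) (k + k)))
      ≡⟨ parity-length-filter-++ onCurve? [ (x , 0) ] _ ⟩
    parity (count [ (x , 0) ]) ℙ.+ parity (count (applyUpTo (λ y → x , suc y) (k + k)))
      ≡⟨ cong (parity (count [ (x , 0) ]) ℙ.+_) (parity-filter-applyUpTo-palindrome onCurve? _ k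
           (λ i j e → onCurve-reflect x {suc i} {suc j} (cong suc (trans (+-suc i j) e)))) ⟩
    parity (count [ (x , 0) ]) ℙ.+ 0ℙ
      ≡⟨ ℙ.+-identityʳ (parity (count [ (x , 0) ])) ⟩
    parity (count [ (x , 0) ])
      ≡⟨ cong parity (length-filter-[]-cong onCurve? onXAxis? (mk⇔ id id)) ⟩
    parity (length (filter onXAxis? [ x ])) ∎
    where
    open ≡-Reasoning
    count : List (ℕ × ℕ) → ℕ
    count xs = length (filter onCurve? xs)

  module _ (p-prime : Prime p) (p∤n : ¬ p ∣ℤ (↥ l)) (p∤d : ¬ p ∣ℤ (↧ l)) where

    private
      1<p : 1 < p
      1<p = nonTrivial⇒n>1 p {{prime⇒nonTrivial p-prime}}

    onXAxis-1 : OnXAxis 1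
    onXAxis-1 = subst (p ∣ℤ_) (sym (pointPoly-x-axis l (+ 1))) (p ∣0)

    ¬sqrtInv-0 : ¬ SqrtInv 0
    ¬sqrtInv-0 = p∤d ∘ subst (p ∣ℤ_) (identity (↥ l ℤ.+ ↧ l) (↧ l))
      where
      identity : ∀ s d → d ℤ.- s ℤ.* + 0 ℤ.* + 0 ≡ d
      identity = solve-∀

    ¬sqrtInv-1 : ¬ SqrtInv 1
    ¬sqrtInv-1 = p∤n ∘ subst (p ∣_) (∣-i∣≡∣i∣ (↥ l)) ∘ subst (p ∣ℤ_) (identity (↥ l) (↧ l))
      where
      identity : ∀ n d → d ℤ.- (n ℤ.+ d) ℤ.* + 1 ℤ.* + 1 ≡ ℤ.- n
      identity = solve-∀

    onXAxis⇔sqrtInv : ∀ {x} → x < p → x ≢ 1 → OnXAxis x ⇔ SqrtInv x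
    onXAxis⇔sqrtInv {x} x<p x≢1 = mk⇔ to′ from′
      where
      D : ℤ
      D = ↧ l ℤ.- (↥ l ℤ.+ ↧ l) ℤ.* + x ℤ.* + x
      factor : ∣ pointPoly l (+ x) (+ 0) ∣ ≡ ∣ + x ℤ.- + 1 ∣ ℕ.* ∣ D ∣
      factor = trans (cong ∣_∣ (pointPoly-x-axis l (+ x))) (abs-* (+ x ℤ.- + 1) D)
      to′ : OnXAxis x → SqrtInv x
      to′ h with euclidsLemma ∣ + x ℤ.- + 1 ∣ ∣ D ∣ p-prime (subst (p ∣_) factor h)
      ... | inj₁ p∣x-1 = ⊥-elim (x≢1 (p∣x-1⇒x≡1 1<p x<p p∣x-1))
      ... | inj₂ p∣D   = p∣D
      from′ : SqrtInv x → OnXAxis x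
      from′ p∣D = subst (p ∣_) (sym factor) (∣n⇒∣m*n ∣ + x ℤ.- + 1 ∣ p∣D)

    parity-sqrtInv : parity (length (filter sqrtInv? (upTo p))) ≡ 0ℙ
    parity-sqrtInv = begin
      parity (length (filter sqrtInv? ([ 0 ] ++ applyUpTo suc (k + k))))
        ≡⟨ parity-length-filter-++ sqrtInv? [ 0 ] _ ⟩
      parity (length (filter sqrtInv? [ 0 ])) ℙ.+ parity (length (filter sqrtInv? (applyUpTo suc (k + k))))
        ≡⟨ cong₂ ℙ._+_ (cong (parity ∘ length) (filter-reject sqrtInv? ¬sqrtInv-0))
                       (parity-filter-applyUpTo-palindrome sqrtInv? suc k
                         (λ i j e → sqrtInv-reflect {suc i} {suc j} (cong suc (trans (+-suc i j) e)))) ⟩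
      0ℙ ∎
      where open ≡-Reasoning

    parity-onXAxis : parity (length (filter onXAxis? (upTo p))) ≡ 1ℙ
    parity-onXAxis = begin
      parity (length (filter onXAxis? (upTo p)))
        ≡⟨ cong parity (length-filter-applyUpTo-except onXAxis? sqrtInv? id p 1 1<p onXAxis-1 ¬sqrtInv-1
                          (λ _ x<p x≢1 → onXAxis⇔sqrtInv x<p x≢1)) ⟩
      parity (1 + length (filter sqrtInv? (upTo p)))
        ≡⟨ ℙ.+-homo-+ 1 (length (filter sqrtInv? (upTo p))) ⟩
      1ℙ ℙ.+ parity (length (filter sqrtInv? (upTo p)))
        ≡⟨ cong (1ℙ ℙ.+_) parity-sqrtInv ⟩
      1ℙ ∎
      where open ≡-Reasoning

    parity-#E : parity (#E l p) ≡ 0ℙ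
    parity-#E = begin
      parity (1 + length (filter onCurve? (cartesianProduct (upTo p) (upTo p))))
        ≡⟨ ℙ.+-homo-+ 1 (length (filter onCurve? (cartesianProduct (upTo p) (upTo p)))) ⟩
      1ℙ ℙ.+ parity (length (filter onCurve? (cartesianProduct (upTo p) (upTo p))))
        ≡⟨ cong (1ℙ ℙ.+_) (parity-filter-cartesianProduct onCurve? onXAxis? (upTo p) (upTo p) parity-onCurve-row) ⟩
      1ℙ ℙ.+ parity (length (filter onXAxis? (upTo p)))
        ≡⟨ cong (1ℙ ℙ.+_) parity-onXAxis ⟩
      0ℙ ∎
      where open ≡-Reasoning

    bλ-even : + 2 ∣ₛ bλ l p
    bλ-even = S.∣m∣n⇒∣m-n (∣ᵤ⇒∣ {+ 2} {+ suc p} (parity≡0ℙ⇒2∣ (suc p) (parity[n+n]≡0ℙ k)))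
                          (∣ᵤ⇒∣ {+ 2} {+ #E l p} (parity≡0ℙ⇒2∣ (#E l p) parity-#E))

    aλp-even : EvenZ (aλp l p)
    aλp-even = ∣⇒∣ᵤ {+ 2} {aλp l p} (S.∣n⇒∣m*n (legendreλ+1 l p)
      (S.∣m∣n⇒∣m-n (S.∣m⇒∣m*n (bλ l p) bλ-even) (∣ᵤ⇒∣ {+ 2} {+ (2 ℕ.* p)} (m∣m*n p))))

    aλpow-step : ∀ m → EvenZ (aλpow l p (suc (suc m))) ⇔ EvenZ (aλpow l p m)
    aλpow-step m = even[ax-qy]⇔even[y] {aλp l p} (aλpow l p (suc m)) (aλpow l p m) {p ℕ.* p} parity[p*p]≡1ℙ aλp-even
      where
      parity[p]≡1ℙ : parity p ≡ 1ℙ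
      parity[p]≡1ℙ = trans (ℙ.+-homo-+ 1 (k + k)) (cong (1ℙ ℙ.+_) (parity[n+n]≡0ℙ k))
      parity[p*p]≡1ℙ : parity (p ℕ.* p) ≡ 1ℙ
      parity[p*p]≡1ℙ = trans (ℙ.*-homo-* p p) (cong₂ ℙ._*_ parity[p]≡1ℙ parity[p]≡1ℙ)

lemma3p5 : (l : ℚ) → l ≢ 0ℚ → l ≢ - 1ℚ →
    (p : ℕ) → Prime p → p ≢ 2 → UnitAt l p →
    EvenZ (aλp l p) × ((d : ℕ) → ((¬ EvenZ (aλpow l p d)) ⇔ (2 ∣ d)))
-- Neither γ nor p ∤ n + d plays a role modulo 2.
lemma3p5 l _ _ p p-prime p≢2 (p∤n , p∤d , _) with prime≢2⇒odd p-prime p≢2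
... | k , refl = aλp-even′ , alternating-parity (aλpow l p) 2∤1 aλp-even′ (aλpow-step l k p-prime p∤n p∤d)
  where
  aλp-even′ : EvenZ (aλp l p)
  aλp-even′ = aλp-even l k p-prime p∤n p∤d
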